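{- Let $CS$ be a constant specification for $\mathcal{GJ}45_{CS}$ and $\Gamma\cup\{\phi\}\subseteq\mathcal{L}_0$. If $\Gamma\vdash_{\mathcal{GJ}45_{CS}}\phi$, then $\Gamma\vdash_{\mathcal{G}}\phi$.
   Context: Justification terms $Jt$: $t::=x\mid c\mid[t\cdot t]\mid[t+t]\mid\,!t\mid\,?t$ ($x$ term variables, $c$ constants, countably many each). Formulas $\mathcal{L}_J$: $\phi::=\bot\mid p\mid(\phi\land\phi)\mid(\phi\rightarrow\phi)\mid t:\phi$, $p\in Var=\{p_i\mid i\in\mathbb{N}\}$; $\neg\phi:=\phi\to\bot$. $\mathcal{L}_0\subseteq\mathcal{L}_J$ is the fragment without $t:$. $\mathcal{G}$ has axiom schemes (A1) $(\phi\to\psi)\to((\psi\to\chi)\to(\phi\to\chi))$, (A2) $(\phi\land\psi)\to\phi$, (A3) $(\phi\land\psi)\to(\psi\land\phi)$, (A5a) $(\phi\to(\psi\to\chi))\to((\phi\land\psi)\to\chi)$, (A5b) $((\phi\land\psi)\to\chi)\to(\phi\to(\psi\to\chi))$, (A6) $((\phi\to\psi)\to\chi)\to(((\psi\to\phi)\to\chi)\to\chi)$, (A7) $\bot\to\phi$, (G4) $\phi\to(\phi\land\phi)$, with modus ponens. $\mathcal{GJ}_0$: all $\mathcal{L}_J$-instances of these, plus (J) $t:(\phi\to\psi)\to(s:\phi\to[t\cdot s]:\psi)$, (+) $t:\phi\to[t+s]:\phi$, $s:\phi\to[t+s]:\phi$, and modus ponens. (PI) $t:\phi\to\,!t:t:\phi$;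 (NI) $\neg t:\phi\to\,?t:\neg t:\phi$. A constant specification for a calculus $\mathcal{S}$ is a downward closed set $CS$ of formulas $c_n:\dots:c_1:\phi$ ($n\ge1$, $c_i$ constants, $\phi$ an axiom of $\mathcal{S}$). $\mathcal{GJ}45_{CS}$ is $\mathcal{GJ}_0+(PI)+(NI)$ plus the rule "infer $c:\psi$ for each $c:\psi\in CS$". $\Gamma\vdash\phi$ denotes derivability from premises $\Gamma$. -}

module Defs where

open import Data.Nat using (ℕ; suc)
open import Data.Product using (_×_; Σ; _,_)
open import Data.Sum using (_⊎_)
open import Data.Unit using (⊤)
open import Data.Empty using (⊥)
open import Relation.Binary.PropositionalEquality using (_≡_)

data Term : Set where
  var  : ℕ → Term
  cst  : ℕ → Term
  _·_  : Term → Term → Term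
  _⊕_  : Term → Term → Term
  !_   : Term → Term
  ¿_   : Term → Term

data Fm : Set where
  ⊥'   : Fm
  atom : ℕ → Fm
  _∧'_ : Fm → Fm → Fm
  _⇒_  : Fm → Fm → Fm
  _∶_  : Term → Fm → Fm

infixr 5 _⇒_
infixr 6 _∧'_
infix 7 _∶_

¬' : Fm → Fm
¬' φ = φ ⇒ ⊥'

IsL0 : Fm → Set
IsL0 ⊥' = ⊤
IsL0 (atom _) = ⊤
IsL0 (φ ∧' ψ) = IsL0 φ × IsL0 ψ
IsL0 (φ ⇒ ψ) = IsL0 φ × IsL0 ψ
IsL0 (_ ∶ _) = ⊥

data GAx : Fm → Set where
  A1  : ∀ φ ψ χ → GAx ((φ ⇒ ψ) ⇒ ((ψ ⇒ χ) ⇒ (φ ⇒ χ)))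
  A2  : ∀ φ ψ → GAx ((φ ∧' ψ) ⇒ φ)
  A3  : ∀ φ ψ → GAx ((φ ∧' ψ) ⇒ (ψ ∧' φ))
  A5a : ∀ φ ψ χ → GAx ((φ ⇒ (ψ ⇒ χ)) ⇒ ((φ ∧' ψ) ⇒ χ))
  A5b : ∀ φ ψ χ → GAx (((φ ∧' ψ) ⇒ χ) ⇒ (φ ⇒ (ψ ⇒ χ)))
  A6  : ∀ φ ψ χ → GAx (((φ ⇒ ψ) ⇒ χ) ⇒ (((ψ ⇒ φ) ⇒ χ) ⇒ χ))
  A7  : ∀ φ → GAx (⊥' ⇒ φ)
  G4  : ∀ φ → GAx (φ ⇒ (φ ∧' φ))

data GJ45Ax : Fm → Set where
  gax  : ∀ {φ} → GAx φ → GJ45Ax φ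
  J    : ∀ t s φ ψ → GJ45Ax (t ∶ (φ ⇒ ψ) ⇒ (s ∶ φ ⇒ (t · s) ∶ ψ))
  sumˡ : ∀ t s φ → GJ45Ax (t ∶ φ ⇒ (t ⊕ s) ∶ φ)
  sumʳ : ∀ t s φ → GJ45Ax (s ∶ φ ⇒ (t ⊕ s) ∶ φ)
  PI   : ∀ t φ → GJ45Ax (t ∶ φ ⇒ (! t) ∶ (t ∶ φ))
  NI   : ∀ t φ → GJ45Ax (¬' (t ∶ φ) ⇒ (¿ t) ∶ ¬' (t ∶ φ))

data CSFormula : Fm → Set where
  base : ∀ c {φ} → GJ45Ax φ → CSFormula (cst c ∶ φ)
  step : ∀ c {ψ} → CSFormula ψ → CSFormula (cst c ∶ ψ)

record ConstSpec : Set₁ where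
  field
    mem       : Fm → Set
    wellForm  : ∀ {φ} → mem φ → CSFormula φ
    downward  : ∀ c ψ → mem (cst c ∶ ψ) → CSFormula ψ → mem ψ

data _⊢GJ45[_]_ (Γ : Fm → Set) (CS : ConstSpec) : Fm → Set where
  hyp  : ∀ {φ} → Γ φ → Γ ⊢GJ45[ CS ] φ
  ax   : ∀ {φ} → GJ45Ax φ → Γ ⊢GJ45[ CS ] φ
  csr  : ∀ {φ} → ConstSpec.mem CS φ → Γ ⊢GJ45[ CS ] φ
  mp   : ∀ {φ ψ} → Γ ⊢GJ45[ CS ] (φ ⇒ ψ) → Γ ⊢GJ45[ CS ] φ → Γ ⊢GJ45[ CS ] ψ

data _⊢G_ (Γ : Fm → Set) : Fm → Set where
  hyp  : ∀ {φ} → Γ φ → Γ ⊢G φ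
  ax   : ∀ {φ} → GAx φ → IsL0 φ → Γ ⊢G φ
  mp   : ∀ {φ ψ} → Γ ⊢G (φ ⇒ ψ) → Γ ⊢G φ → Γ ⊢G ψ

module Submission where

-- Erasing every justification, t ∶ φ ↦ φ, sends each axiom of GJ45 either to an
-- instance of a G scheme or (for J, +, PI, NI and constant specifications) to a
-- formula of the shape χ ⇒ χ, which G proves; modus ponens commutes with the
-- erasure, and L0 formulas are left unchanged by it.

open import Defs
open import Data.Product using (_,_)
open import Data.Unit using (tt)
open import Relation.Binary.PropositionalEquality using (_≡_; refl; cong₂; subst; sym)

forget : Fm → Fm
forget ⊥' = ⊥'
forget (atom n) = atom n
forget (φ ∧' ψ) = forget φ ∧' forget ψ
forget (φ ⇒ ψ) = forget φ ⇒ forget ψ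
forget (t ∶ φ) = forget φ

IsL0-forget : ∀ φ → IsL0 (forget φ)
IsL0-forget ⊥' = tt
IsL0-forget (atom n) = tt
IsL0-forget (φ ∧' ψ) = IsL0-forget φ , IsL0-forget ψ
IsL0-forget (φ ⇒ ψ) = IsL0-forget φ , IsL0-forget ψ
IsL0-forget (t ∶ φ) = IsL0-forget φ

forget-L0 : ∀ φ → IsL0 φ → forget φ ≡ φ
forget-L0 ⊥' _ = refl
forget-L0 (atom n) _ = refl
forget-L0 (φ ∧' ψ) (l , m) = cong₂ _∧'_ (forget-L0 φ l) (forget-L0 ψ m)
forget-L0 (φ ⇒ ψ) (l , m) = cong₂ _⇒_ (forget-L0 φ l) (forget-L0 ψ m)

GAx-forget : ∀ {φ} → GAx φ → GAx (forget φ)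
GAx-forget (A1 φ ψ χ) = A1 (forget φ) (forget ψ) (forget χ)
GAx-forget (A2 φ ψ) = A2 (forget φ) (forget ψ)
GAx-forget (A3 φ ψ) = A3 (forget φ) (forget ψ)
GAx-forget (A5a φ ψ χ) = A5a (forget φ) (forget ψ) (forget χ)
GAx-forget (A5b φ ψ χ) = A5b (forget φ) (forget ψ) (forget χ)
GAx-forget (A6 φ ψ χ) = A6 (forget φ) (forget ψ) (forget χ)
GAx-forget (A7 φ) = A7 (forget φ)
GAx-forget (G4 φ) = G4 (forget φ)

module _ {Γ : Fm → Set} where

  ⊢G-⇒-refl : ∀ φ → IsL0 φ → Γ ⊢G (φ ⇒ φ)
  ⊢G-⇒-refl φ l =
    mp (mp (ax (A1 φ (φ ∧' φ) φ) ((l , (l , l)) , (((l , l) , l) , (l , l))))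
           (ax (G4 φ) (l , (l , l))))
       (ax (A2 φ φ) ((l , l) , l))

  ⊢G-forget-⇒-refl : ∀ φ → Γ ⊢G forget (φ ⇒ φ)
  ⊢G-forget-⇒-refl φ = ⊢G-⇒-refl (forget φ) (IsL0-forget φ)

  ⊢G-forget-GJ45Ax : ∀ {φ} → GJ45Ax φ → Γ ⊢G forget φ
  ⊢G-forget-GJ45Ax {φ} (gax g) = ax (GAx-forget g) (IsL0-forget φ)
  ⊢G-forget-GJ45Ax (J t s φ ψ) = ⊢G-forget-⇒-refl (φ ⇒ ψ)
  ⊢G-forget-GJ45Ax (sumˡ t s φ) = ⊢G-forget-⇒-refl φ
  ⊢G-forget-GJ45Ax (sumʳ t s φ) = ⊢G-forget-⇒-refl φ
  ⊢G-forget-GJ45Ax (PI t φ) = ⊢G-forget-⇒-refl φ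
  ⊢G-forget-GJ45Ax (NI t φ) = ⊢G-forget-⇒-refl (¬' φ)

  ⊢G-forget-CSFormula : ∀ {φ} → CSFormula φ → Γ ⊢G forget φ
  ⊢G-forget-CSFormula (base c a) = ⊢G-forget-GJ45Ax a
  ⊢G-forget-CSFormula (step c f) = ⊢G-forget-CSFormula f

  ⊢GJ45⇒⊢G-forget : ∀ {CS φ} → (∀ ψ → Γ ψ → Γ (forget ψ)) →
                    Γ ⊢GJ45[ CS ] φ → Γ ⊢G forget φ
  ⊢GJ45⇒⊢G-forget {φ = φ} Γ-forget (hyp g) = hyp (Γ-forget φ g)
  ⊢GJ45⇒⊢G-forget Γ-forget (ax a) = ⊢G-forget-GJ45Ax a
  ⊢GJ45⇒⊢G-forget {CS} Γ-forget (csr m) = ⊢G-forget-CSFormula (ConstSpec.wellForm CS m)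
  ⊢GJ45⇒⊢G-forget Γ-forget (mp d e) = mp (⊢GJ45⇒⊢G-forget Γ-forget d) (⊢GJ45⇒⊢G-forget Γ-forget e)

mainTheorem5 : (CS : ConstSpec) (Γ : Fm → Set) (φ : Fm) → (∀ ψ → Γ ψ → IsL0 ψ) → IsL0 φ → Γ ⊢GJ45[ CS ] φ → Γ ⊢G φ
mainTheorem5 CS Γ φ Γ-L0 φ-L0 d = subst (Γ ⊢G_) (forget-L0 φ φ-L0) (⊢GJ45⇒⊢G-forget Γ-forget d)
  where
  Γ-forget : ∀ ψ → Γ ψ → Γ (forget ψ)
  Γ-forget ψ g = subst Γ (sym (forget-L0 ψ (Γ-L0 ψ g))) g
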